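{- Let $D=(V,A)$ be a digraph with radius $r$. Then for every vertex $x\in V$, $$\sum_{v \in V \setminus \{x\}} \left( d(x,v)-1+d(v,x)-1 \right) \ge \left\lfloor \left(r-\tfrac12\right)^2 \right\rfloor.$$
   Context: $d(x,y)$ is the length of a shortest directed path from $x$ to $y$. The radius of $D$ is $\min_{x\in V} \frac{d(x,V)+d(V,x)}{2}$, where $d(x,V)=\max_{v} d(x,v)$ and $d(V,x)=\max_v d(v,x)$; thus $r\in\frac12\mathbb{Z}$. -}

module Defs where

open import Data.Nat using (ℕ; zero; suc; _+_; _*_; _∸_; _≤_; _⊔_; _⊓_; _/_)
open import Data.Fin using (Fin; _≟_)
open import Data.List using (List; map; filter; allFin)
open import Data.Nat.ListAction using (sum)
open import Data.Vec using (tabulate; foldr₁)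
open import Data.Product using (_×_)
open import Relation.Nullary using (¬?)

data Walk {n : ℕ} (E : Fin n → Fin n → Set) : Fin n → Fin n → ℕ → Set where
  here : ∀ {x} → Walk E x x zero
  step : ∀ {x y z k} → E x y → Walk E y z k → Walk E x z (suc k)

IsShortest : {n : ℕ} → (Fin n → Fin n → Set) → Fin n → Fin n → ℕ → Set
IsShortest E x y k = Walk E x y k × (∀ m → Walk E x y m → k ≤ m)

IsDistance : {n : ℕ} → (Fin n → Fin n → Set) → (Fin n → Fin n → ℕ) → Set
IsDistance E d = ∀ x y → IsShortest E x y (d x y)

maxV : {m : ℕ} → (Fin (suc m) → ℕ) → ℕ
maxV f = foldr₁ _⊔_ (tabulate f)

minV : {m : ℕ} → (Fin (suc m) → ℕ) → ℕ
minV f = foldr₁ _⊓_ (tabulate f)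

totalEcc : {m : ℕ} → (Fin (suc m) → Fin (suc m) → ℕ) → Fin (suc m) → ℕ
totalEcc d x = maxV (λ v → d x v) + maxV (λ v → d v x)

-- twice the radius: 2r = min_x (d(x,V) + d(V,x))
twiceRadius : {m : ℕ} → (Fin (suc m) → Fin (suc m) → ℕ) → ℕ
twiceRadius d = minV (totalEcc d)

-- floor((r - 1/2)^2) = floor((2r-1)^2 / 4), with 2r given as R.
-- For R = 0 we have (r-1/2)^2 = 1/4, floor 0, matching (0 ∸ 1)^2 / 4 = 0.
floorSqRadiusMinusHalf : ℕ → ℕ
floorSqRadiusMinusHalf R = ((R ∸ 1) * (R ∸ 1)) / 4

lhsSum : {m : ℕ} → (Fin (suc m) → Fin (suc m) → ℕ) → Fin (suc m) → ℕ
lhsSum {m} d x =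
  sum (map (λ v → (d x v ∸ 1) + (d v x ∸ 1))
           (filter (λ v → ¬? (v ≟ x)) (allFin (suc m))))

{-# OPTIONS --safe #-}
module Submission where

-- Let a = d(x,V) and b = d(V,x). Along a shortest path from x to a vertex at
-- distance a, every distance 1, …, a from x is attained, so the out-distances
-- contribute at least 0 + 1 + ⋯ + (a − 1) to the sum; likewise the in-distances
-- contribute at least 0 + 1 + ⋯ + (b − 1). Since 2r ≤ a + b, it remains to check
-- (a + b − 1)² ≤ 2a(a − 1) + 2b(b − 1) + 1, i.e. 0 ≤ (a − b)².

open import Defs
open import Data.Nat using (ℕ; zero; suc; _≥_; _+_; _*_; _∸_; _≤_; z≤n; s≤s; s≤s⁻¹)
open import Data.Nat.Properties hiding (_≟_)
open import Data.Nat.DivMod using (m<n*o⇒m/o<n)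
open import Data.Nat.ListAction using (sum)
open import Data.Nat.ListAction.Properties using (sum-↭)
open import Data.Nat.Tactic.RingSolver using (solve-∀)
open import Data.Fin using (Fin; _≟_) renaming (zero to fzero; suc to fsuc)
open import Data.List using (List; []; _∷_; map; filter; allFin)
open import Data.List.Properties using (map-∘)
open import Data.List.Relation.Unary.Any using (here; there)
open import Data.List.Membership.Propositional using (_∈_)
open import Data.List.Membership.Propositional.Properties using (∈-map⁺; ∈-filter⁺; ∈-allFin; ∈-∃++)
open import Data.List.Relation.Binary.Permutation.Propositional using (_↭_)
open import Data.List.Relation.Binary.Permutation.Propositional.Properties using (shift; ∈-resp-↭; map⁺)
open import Data.Product using (∃; _×_; _,_; proj₁; proj₂)
open import Data.Sum using (inj₁; inj₂; [_,_]′)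
open import Function using (_∘_)
open import Relation.Nullary using (¬?; contradiction)
open import Relation.Binary.PropositionalEquality

sumBelow : ℕ → ℕ
sumBelow zero    = 0
sumBelow (suc n) = n + sumBelow n

2*sumBelow+n≡n*n : ∀ n → 2 * sumBelow n + n ≡ n * n
2*sumBelow+n≡n*n zero    = refl
2*sumBelow+n≡n*n (suc n) = begin
  2 * (n + sumBelow n) + suc n   ≡⟨ regroup n (sumBelow n) ⟩
  2 * n + (2 * sumBelow n + n) + 1 ≡⟨ cong (λ t → 2 * n + t + 1) (2*sumBelow+n≡n*n n) ⟩
  2 * n + n * n + 1              ≡⟨ square-suc n ⟩
  suc n * suc n                  ∎
  where
  open ≡-Reasoning
  regroup : ∀ n s → 2 * (n + s) + suc n ≡ 2 * n + (2 * s + n) + 1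
  regroup = solve-∀
  square-suc : ∀ n → 2 * n + n * n + 1 ≡ suc n * suc n
  square-suc = solve-∀

2*[m*n]≤m*m+n*n : ∀ m n → 2 * (m * n) ≤ m * m + n * n
2*[m*n]≤m*m+n*n m n = [ ordered , swapped ]′ (≤-total m n)
  where
  square-gap : ∀ m c → 2 * (m * (m + c)) + c * c ≡ m * m + (m + c) * (m + c)
  square-gap = solve-∀
  ordered : ∀ {p q} → p ≤ q → 2 * (p * q) ≤ p * p + q * q
  ordered {p} p≤q with c , refl ← m≤n⇒∃[o]m+o≡n p≤q =
    subst (2 * (p * (p + c)) ≤_) (square-gap p c) (m≤m+n _ (c * c))
  swapped : n ≤ m → 2 * (m * n) ≤ m * m + n * n
  swapped n≤m = subst₂ _≤_ (cong (2 *_) (*-comm n m)) (+-comm (n * n) (m * m)) (ordered n≤m)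

[m+n]*[m+n]≤4*[sumBelow]+2*[m+n] : ∀ m n →
  (m + n) * (m + n) ≤ 4 * (sumBelow m + sumBelow n) + 2 * (m + n)
[m+n]*[m+n]≤4*[sumBelow]+2*[m+n] m n = begin
  (m + n) * (m + n)                                  ≡⟨ expand m n ⟩
  m * m + n * n + 2 * (m * n)                        ≤⟨ +-monoʳ-≤ (m * m + n * n) (2*[m*n]≤m*m+n*n m n) ⟩
  m * m + n * n + (m * m + n * n)                    ≡⟨ cong (λ t → t + t) (sym (cong₂ _+_ (2*sumBelow+n≡n*n m) (2*sumBelow+n≡n*n n))) ⟩
  2 * sumBelow m + m + (2 * sumBelow n + n) + (2 * sumBelow m + m + (2 * sumBelow n + n))
                                                     ≡⟨ collect m n (sumBelow m) (sumBelow n) ⟩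
  4 * (sumBelow m + sumBelow n) + 2 * (m + n)        ∎
  where
  open ≤-Reasoning
  expand : ∀ m n → (m + n) * (m + n) ≡ m * m + n * n + 2 * (m * n)
  expand = solve-∀
  collect : ∀ m n s t → 2 * s + m + (2 * t + n) + (2 * s + m + (2 * t + n)) ≡ 4 * (s + t) + 2 * (m + n)
  collect = solve-∀

[n∸1]*[n∸1]+2*n≤n*n+1 : ∀ n → (n ∸ 1) * (n ∸ 1) + 2 * n ≤ n * n + 1
[n∸1]*[n∸1]+2*n≤n*n+1 zero    = z≤n
[n∸1]*[n∸1]+2*n≤n*n+1 (suc n) = ≤-reflexive (square-suc n)
  where
  square-suc : ∀ n → n * n + 2 * suc n ≡ suc n * suc n + 1
  square-suc = solve-∀

floorSqRadiusMinusHalf≤sumBelow+sumBelow : ∀ {R} m n → R ≤ m + n →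
  floorSqRadiusMinusHalf R ≤ sumBelow m + sumBelow n
floorSqRadiusMinusHalf≤sumBelow+sumBelow {R} m n R≤m+n =
  s≤s⁻¹ (m<n*o⇒m/o<n {n = suc S} {o = 4} (begin-strict
    (R ∸ 1) * (R ∸ 1)         ≤⟨ *-mono-≤ R∸1≤ R∸1≤ ⟩
    (m + n ∸ 1) * (m + n ∸ 1) ≤⟨ +-cancelʳ-≤ (2 * (m + n)) _ _ squares≤ ⟩
    4 * S + 1                 <⟨ +-monoʳ-< (4 * S) (s≤s (s≤s z≤n)) ⟩
    4 * S + 4                 ≡⟨ trans (+-comm (4 * S) 4) (cong (4 +_) (*-comm 4 S)) ⟩
    suc S * 4                 ∎))
  where
  open ≤-Reasoning
  S = sumBelow m + sumBelow n
  R∸1≤ : R ∸ 1 ≤ m + n ∸ 1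
  R∸1≤ = ∸-monoˡ-≤ 1 R≤m+n
  squares≤ : (m + n ∸ 1) * (m + n ∸ 1) + 2 * (m + n) ≤ 4 * S + 1 + 2 * (m + n)
  squares≤ = begin
    (m + n ∸ 1) * (m + n ∸ 1) + 2 * (m + n) ≤⟨ [n∸1]*[n∸1]+2*n≤n*n+1 (m + n) ⟩
    (m + n) * (m + n) + 1                   ≤⟨ +-monoˡ-≤ 1 ([m+n]*[m+n]≤4*[sumBelow]+2*[m+n] m n) ⟩
    4 * S + 2 * (m + n) + 1                 ≡⟨ +-comm-right (4 * S) (2 * (m + n)) 1 ⟩
    4 * S + 1 + 2 * (m + n)                 ∎
    where
    +-comm-right : ∀ a b c → a + b + c ≡ a + c + b
    +-comm-right = solve-∀

∈⇒↭∷ : ∀ {A : Set} {x : A} {xs} → x ∈ xs → ∃ λ rest → xs ↭ x ∷ rest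
∈⇒↭∷ x∈xs with ys , zs , refl ← ∈-∃++ x∈xs = _ , shift _ ys zs

sumBelow≤sum-pred : ∀ a ns → (∀ {j} → 1 ≤ j → j ≤ a → j ∈ ns) →
  sumBelow a ≤ sum (map (_∸ 1) ns)
sumBelow≤sum-pred zero    ns covers = z≤n
sumBelow≤sum-pred (suc a) ns covers with rest , ns↭ ← ∈⇒↭∷ (covers (s≤s z≤n) ≤-refl) =
  subst (sumBelow (suc a) ≤_) (sym (sum-↭ (map⁺ (_∸ 1) ns↭)))
    (+-monoʳ-≤ a (sumBelow≤sum-pred a rest covers-rest))
  where
  covers-rest : ∀ {j} → 1 ≤ j → j ≤ a → j ∈ rest
  covers-rest 1≤j j≤a with ∈-resp-↭ ns↭ (covers 1≤j (m≤n⇒m≤1+n j≤a))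
  ... | here refl = contradiction j≤a (<-irrefl refl)
  ... | there j∈rest = j∈rest

sum-map-+ : ∀ {A : Set} (f g : A → ℕ) xs →
  sum (map (λ x → f x + g x) xs) ≡ sum (map f xs) + sum (map g xs)
sum-map-+ f g []       = refl
sum-map-+ f g (x ∷ xs) = trans (cong (f x + g x +_) (sum-map-+ f g xs)) (+-interchange (f x) (g x) _ _)
  where
  +-interchange : ∀ a b c d → a + b + (c + d) ≡ a + c + (b + d)
  +-interchange = solve-∀

maxV-attained : ∀ {m} (f : Fin (suc m) → ℕ) → ∃ λ i → maxV f ≡ f i
maxV-attained {zero}  f = fzero , refl
maxV-attained {suc m} f with maxV-attained (f ∘ fsuc) | ≤-total (f fzero) (maxV (f ∘ fsuc))
... | i , maxTail≡ | inj₁ ≤tail = fsuc i , trans (m≤n⇒m⊔n≡n ≤tail) maxTail≡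
... | _          | inj₂ tail≤ = fzero , m≥n⇒m⊔n≡m tail≤

minV≤ : ∀ {m} (f : Fin (suc m) → ℕ) i → minV f ≤ f i
minV≤ {zero}  f fzero    = ≤-refl
minV≤ {suc m} f fzero    = m⊓n≤m (f fzero) _
minV≤ {suc m} f (fsuc i) = ≤-trans (m⊓n≤n (f fzero) _) (minV≤ (f ∘ fsuc) i)

others : ∀ {n} → Fin n → List (Fin n)
others {n} x = filter (λ v → ¬? (v ≟ x)) (allFin n)

∈-map-others : ∀ {n} (h : Fin n → ℕ) {x w} → h x ≡ 0 → 1 ≤ h w → h w ∈ map h (others x)
∈-map-others h hx≡0 1≤hw =
  ∈-map⁺ h (∈-filter⁺ (λ v → ¬? (v ≟ _)) (∈-allFin _) λ { refl → <-irrefl (sym hx≡0) 1≤hw })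

lhsSum≡out+in : ∀ {m} (d : Fin (suc m) → Fin (suc m) → ℕ) x → lhsSum d x ≡
  sum (map (_∸ 1) (map (d x) (others x))) + sum (map (_∸ 1) (map (λ v → d v x) (others x)))
lhsSum≡out+in d x = trans (sum-map-+ (λ v → d x v ∸ 1) (λ v → d v x ∸ 1) (others x))
  (cong₂ _+_ (cong sum (map-∘ (others x))) (cong sum (map-∘ (others x))))

module _ {n : ℕ} {E : Fin n → Fin n → Set} where

  Walk-split : ∀ {x z} i j → Walk E x z (i + j) → ∃ λ w → Walk E x w i × Walk E w z j
  Walk-split zero    j p          = _ , here , p
  Walk-split (suc i) j (step e p) with w , q , r ← Walk-split i j p = w , step e q , r

  Walk-++ : ∀ {x y z i j} → Walk E x y i → Walk E y z j → Walk E x z (i + j)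
  Walk-++ here       q = q
  Walk-++ (step e p) q = step e (Walk-++ p q)

module _ {n : ℕ} {E : Fin n → Fin n → Set} {d : Fin n → Fin n → ℕ} (isDistance : IsDistance E d) where

  d-refl : ∀ x → d x x ≡ 0
  d-refl x = n≤0⇒n≡0 (proj₂ (isDistance x x) 0 here)

  d-triangle : ∀ x y z → d x z ≤ d x y + d y z
  d-triangle x y z = proj₂ (isDistance x z) _
    (Walk-++ (proj₁ (isDistance x y)) (proj₁ (isDistance y z)))

  d-split : ∀ {x z} i j → d x z ≡ i + j → ∃ λ w → d x w ≡ i × d w z ≡ j
  d-split {x} {z} i j dxz≡ with w , p , q ← Walk-split i j (subst (Walk E x z) dxz≡ (proj₁ (isDistance x z))) =
    w , ≤-antisym dxw≤i i≤dxw , ≤-antisym dwz≤j j≤dwz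
    where
    dxw≤i : d x w ≤ i
    dxw≤i = proj₂ (isDistance x w) i p
    dwz≤j : d w z ≤ j
    dwz≤j = proj₂ (isDistance w z) j q
    i+j≤ : i + j ≤ d x w + d w z
    i+j≤ = subst (_≤ d x w + d w z) dxz≡ (d-triangle x w z)
    i≤dxw : i ≤ d x w
    i≤dxw = +-cancelʳ-≤ j i (d x w) (≤-trans i+j≤ (+-monoʳ-≤ (d x w) dwz≤j))
    j≤dwz : j ≤ d w z
    j≤dwz = +-cancelˡ-≤ i j (d w z) (≤-trans i+j≤ (+-monoˡ-≤ (d w z) dxw≤i))

  out-distances-cover : ∀ x y {j} → 1 ≤ j → j ≤ d x y → j ∈ map (d x) (others x)
  out-distances-cover x y {j} 1≤j j≤dxy
    with w , dxw≡j , _ ← d-split j (d x y ∸ j) (sym (m+[n∸m]≡n j≤dxy)) =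
    subst (_∈ _) dxw≡j (∈-map-others (d x) (d-refl x) (subst (1 ≤_) (sym dxw≡j) 1≤j))

  in-distances-cover : ∀ x y {j} → 1 ≤ j → j ≤ d y x → j ∈ map (λ v → d v x) (others x)
  in-distances-cover x y {j} 1≤j j≤dyx
    with w , _ , dwx≡j ← d-split (d y x ∸ j) j (sym (m∸n+n≡m j≤dyx)) =
    subst (_∈ _) dwx≡j (∈-map-others (λ v → d v x) (d-refl x) (subst (1 ≤_) (sym dwx≡j) 1≤j))

proposition3 : (m : ℕ) (E : Fin (suc m) → Fin (suc m) → Set)
    (d : Fin (suc m) → Fin (suc m) → ℕ) → IsDistance E d →
    (x : Fin (suc m)) → lhsSum d x ≥ floorSqRadiusMinusHalf (twiceRadius d)
proposition3 m E d isDistance x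
  with y , maxOut≡ ← maxV-attained (d x) | y′ , maxIn≡ ← maxV-attained (λ v → d v x) = begin
    floorSqRadiusMinusHalf (twiceRadius d)
      ≤⟨ floorSqRadiusMinusHalf≤sumBelow+sumBelow (d x y) (d y′ x) twiceRadius≤ ⟩
    sumBelow (d x y) + sumBelow (d y′ x)
      ≤⟨ +-mono-≤ (sumBelow≤sum-pred _ _ (out-distances-cover isDistance x y))
                  (sumBelow≤sum-pred _ _ (in-distances-cover isDistance x y′)) ⟩
    sum (map (_∸ 1) (map (d x) (others x))) + sum (map (_∸ 1) (map (λ v → d v x) (others x)))
      ≡⟨ lhsSum≡out+in d x ⟨
    lhsSum d x ∎
  where
  open ≤-Reasoning
  twiceRadius≤ : twiceRadius d ≤ d x y + d y′ x
  twiceRadius≤ = subst (twiceRadius d ≤_) (cong₂ _+_ maxOut≡ maxIn≡) (minV≤ (totalEcc d) x)
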